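{- Let $k\geq 3$ be an integer and let \[ A=\{0,1\}\cup\{3,4,\ldots,k-1\}\cup\{k+2\}\subseteq \mathbb{Z}_{2k}. \] Then $A$ is aperiodic: for every subgroup $H$ of $\mathbb{Z}_{2k}$ with $H\neq\{0\}$, we have $A+H\neq A$.
   Context: $A+H=\{a+h:a\in A,h\in H\}$. -}

module Defs where

open import Data.Nat using (ℕ; zero; suc; _+_; _∸_; _≤_; _*_)
open import Data.Nat.DivMod using (_mod_)
open import Data.Fin using (Fin; toℕ)
open import Data.Product using (Σ; _×_; ∃-syntax)
open import Data.Sum using (_⊎_)
open import Relation.Binary.PropositionalEquality using (_≡_)
open import Relation.Nullary using (¬_)

-- The cyclic group ℤ_n, carrier Fin n, operations modulo n.
-- (Fin 0 is empty, so the n = 0 cases are vacuous.)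
0ₙ : ∀ {n} → Fin (suc n)
0ₙ = Fin.zero

_+ₙ_ : ∀ {n} → Fin n → Fin n → Fin n
_+ₙ_ {suc m} x y = (toℕ x + toℕ y) mod (suc m)

-ₙ_ : ∀ {n} → Fin n → Fin n
-ₙ_ {suc m} x = (suc m ∸ toℕ x) mod (suc m)

Subset : ℕ → Set₁
Subset n = Fin n → Set

record IsSubgroup {n : ℕ} (H : Subset (suc n)) : Set where
  field
    has-0   : H 0ₙ
    closed+ : ∀ {x y} → H x → H y → H (x +ₙ y)
    closed- : ∀ {x} → H x → H (-ₙ x)

NonTrivial : ∀ {n} → Subset (suc n) → Set
NonTrivial H = ∃[ h ] (H h × ¬ (h ≡ 0ₙ))

_⊕_ : ∀ {n} → Subset n → Subset n → Subset n
(A ⊕ H) x = ∃[ a ] ∃[ h ] (A a × H h × x ≡ a +ₙ h)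

_≐_ : ∀ {n} → Subset n → Subset n → Set
B ≐ C = ∀ x → (B x → C x) × (C x → B x)

-- The set A = {0,1} ∪ {3,…,k-1} ∪ {k+2} ⊆ ℤ_{2k}, by representatives in [0,2k).
Aₖ : (k : ℕ) → Subset (suc (2 * k ∸ 1))
Aₖ k x = (toℕ x ≡ 0 ⊎ toℕ x ≡ 1) ⊎ ((3 ≤ toℕ x × suc (toℕ x) ≤ k) ⊎ toℕ x ≡ k + 2)

module Submission where

-- Suppose A + H = A for a nontrivial subgroup H of ℤ_{2k} and
-- pick h ∈ H, h ≠ 0, with representative t ∈ [1, 2k).  It suffices to find an
-- "escape" for t: some a ∈ A with a + t < 2k (so no reduction mod 2k happens)
-- and a + t ∉ A, since then a + h ∈ A + H would lie outside A.

open import Defs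
open import Data.Nat using (ℕ; zero; suc; _+_; _*_; _∸_; _≤_; _<_; z≤n; s≤s; _≟_; _≤?_)
open import Data.Nat.Properties
open import Data.Nat.DivMod using (_mod_; m<n⇒m%n≡m)
open import Data.Fin using (Fin; toℕ; fromℕ<)
import Data.Fin as Fin
open import Data.Fin.Properties using (toℕ-fromℕ<; toℕ<n)
open import Data.Product using (_×_; _,_; proj₁)
open import Data.Sum using (_⊎_; inj₁; inj₂)
open import Relation.Nullary using (¬_; yes; no)
open import Relation.Binary.PropositionalEquality

toℕ-mod-small : ∀ {n m} → m < suc n → toℕ (m mod suc n) ≡ m
toℕ-mod-small m<n = trans (toℕ-fromℕ< _) (m<n⇒m%n≡m m<n)

toℕ-+ₙ : ∀ {n} (x y : Fin (suc n)) → toℕ x + toℕ y < suc n →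
         toℕ (x +ₙ y) ≡ toℕ x + toℕ y
toℕ-+ₙ x y = toℕ-mod-small

toℕ-nonzero : ∀ {n} (x : Fin (suc n)) → ¬ (x ≡ 0ₙ) → 1 ≤ toℕ x
toℕ-nonzero Fin.zero    x≢0 with () ← x≢0 refl
toℕ-nonzero (Fin.suc y) _ = s≤s z≤n

toℕ--ₙ : ∀ {n} (x : Fin (suc n)) → ¬ (x ≡ 0ₙ) → toℕ (-ₙ x) ≡ suc n ∸ toℕ x
toℕ--ₙ Fin.zero    x≢0 with () ← x≢0 refl
toℕ--ₙ {n} (Fin.suc y) _ = toℕ-mod-small (s≤s (m∸n≤m n (toℕ y)))

⟦_⟧ : ∀ {n} → (ℕ → Set) → Subset n
⟦ P ⟧ x = P (toℕ x)

shift-closed : ∀ {n} (P : ℕ → Set) (H : Subset (suc n)) → (⟦ P ⟧ ⊕ H) ≐ ⟦ P ⟧ →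
               ∀ {h} → H h → ∀ {v} → P v → v + toℕ h < suc n → P (v + toℕ h)
shift-closed {n} P H P+H≐P {h} h∈H {v} Pv v+h<n =
  subst P (trans (toℕ-+ₙ a h a+h<n) (cong (_+ toℕ h) toℕ-a))
    (proj₁ (P+H≐P (a +ₙ h)) (a , h , Pa , h∈H , refl))
  where
  v<n : v < suc n
  v<n = ≤-<-trans (m≤m+n v (toℕ h)) v+h<n
  a : Fin (suc n)
  a = fromℕ< v<n
  toℕ-a : toℕ a ≡ v
  toℕ-a = toℕ-fromℕ< v<n
  Pa : ⟦ P ⟧ a
  Pa = subst P (sym toℕ-a) Pv
  a+h<n : toℕ a + toℕ h < suc n
  a+h<n = subst (λ w → w + toℕ h < suc n) (sym toℕ-a) v+h<n

record Escape (P : ℕ → Set) (n t : ℕ) : Set where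
  field
    start    : ℕ
    land     : ℕ
    shifted  : start + t ≡ land
    start∈P  : P start
    land<n   : land < n
    land∉P   : ¬ P land

no-escape : ∀ {n} (P : ℕ → Set) (H : Subset (suc n)) → (⟦ P ⟧ ⊕ H) ≐ ⟦ P ⟧ →
            ∀ {h} → H h → ¬ Escape P (suc n) (toℕ h)
no-escape P H P+H≐P h∈H e = land∉P (subst P shifted
  (shift-closed P H P+H≐P h∈H start∈P (subst (_< _) (sym shifted) land<n)))
  where open Escape e

-- Step 3: the set A = {0,1} ∪ [3,k-1] ∪ {k+2}, as a predicate on ℕ;
-- the subset Aₖ k of Defs is ⟦ InA k ⟧ by definition.
InA : ℕ → ℕ → Set
InA k v = (v ≡ 0 ⊎ v ≡ 1) ⊎ ((3 ≤ v × suc v ≤ k) ⊎ v ≡ k + 2)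

2∉A : ∀ {k} → 3 ≤ k → ¬ InA k 2
2∉A k≥3 (inj₁ (inj₁ ()))
2∉A k≥3 (inj₁ (inj₂ ()))
2∉A k≥3 (inj₂ (inj₁ (s≤s (s≤s ()) , _)))
2∉A {k} k≥3 (inj₂ (inj₂ 2≡k+2)) = <⇒≢ (≤-trans k≥3 (m≤m+n k 2)) 2≡k+2

upper-gap : ∀ {k s} → 3 ≤ k → k ≤ s → ¬ (s ≡ k + 2) → ¬ InA k s
upper-gap k≥3 k≤s s≢k+2 (inj₁ (inj₁ refl)) with () ← ≤-trans k≥3 k≤s
upper-gap k≥3 k≤s s≢k+2 (inj₁ (inj₂ refl)) with s≤s () ← ≤-trans k≥3 k≤s
upper-gap k≥3 k≤s s≢k+2 (inj₂ (inj₁ (_ , s<k))) = <-irrefl refl (<-≤-trans s<k k≤s)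
upper-gap k≥3 k≤s s≢k+2 (inj₂ (inj₂ s≡k+2)) = s≢k+2 s≡k+2

m<k⇒m<2k : ∀ {k m} → m < k → m < 2 * k
m<k⇒m<2k {k} m<k = <-≤-trans m<k (m≤m+n k (k + 0))

k+m<2k : ∀ {k m} → m < k → k + m < 2 * k
k+m<2k {k} m<k = +-monoʳ-< k (<-≤-trans m<k (m≤m+n k 0))

k<2k : ∀ {k} → 1 ≤ k → k < 2 * k
k<2k {k} k≥1 = subst (_< 2 * k) (+-identityʳ k) (k+m<2k k≥1)

≤2+-cases : ∀ {k t} → k ≤ 2 + t → k ≡ 2 + t ⊎ k ≡ 1 + t ⊎ k ≤ t
≤2+-cases k≤2+t with m≤n⇒m<n∨m≡n k≤2+t
... | inj₂ k≡2+t = inj₁ k≡2+t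
... | inj₁ (s≤s k≤1+t) with m≤n⇒m<n∨m≡n k≤1+t
...   | inj₂ k≡1+t = inj₂ (inj₁ k≡1+t)
...   | inj₁ (s≤s k≤t) = inj₂ (inj₂ k≤t)

-- Every shift t ∈ [1, 2k) other than k+2 escapes from A below 2k
-- (cases taken in this order):
--   t + 3 ≤ k      : k+2 ↦ k+2+t ∈ (k+2, 2k),
--   t = 1          : 1 ↦ 2,
--   t + 2 = k      : 3 ↦ k+1,
--   t + 1 = k      : 1 ↦ k,
--   k ≤ t          : 0 ↦ t.
escape : ∀ {k t} → 3 ≤ k → 1 ≤ t → t < 2 * k → ¬ (t ≡ k + 2) → Escape (InA k) (2 * k) t
escape {k} {t} k≥3 t≥1 t<2k t≢k+2 with 3 + t ≤? k
... | yes 3+t≤k = record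
  { start = k + 2 ; land = k + 2 + t ; shifted = refl ; start∈P = inj₂ (inj₂ refl)
  ; land<n = subst (_< 2 * k) (sym (+-assoc k 2 t)) (k+m<2k 3+t≤k)
  ; land∉P = upper-gap k≥3 (≤-trans (m≤m+n k 2) (m≤m+n (k + 2) t)) (>⇒≢ (m<m+n (k + 2) t≥1)) }
escape {k} {suc zero} k≥3 _ _ _ | no _ = record
  { start = 1 ; land = 2 ; shifted = refl ; start∈P = inj₁ (inj₂ refl)
  ; land<n = m<k⇒m<2k k≥3 ; land∉P = 2∉A k≥3 }
escape {k} {t@(suc (suc _))} k≥3 _ t<2k t≢k+2 | no 3+t≰k with ≤2+-cases {k} {t} (≤-pred (≰⇒> 3+t≰k))
... | inj₁ k≡2+t = record
  { start = 3 ; land = suc k ; shifted = cong suc (sym k≡2+t)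
  ; start∈P = inj₂ (inj₁ (≤-refl , subst (4 ≤_) (sym k≡2+t) (s≤s (s≤s (s≤s (s≤s z≤n))))))
  ; land<n = subst (_< 2 * k) (+-comm k 1) (k+m<2k (≤-trans (s≤s (s≤s z≤n)) k≥3))
  ; land∉P = upper-gap k≥3 (n≤1+n k) (<⇒≢ (subst (_< k + 2) (+-comm k 1) (+-monoʳ-< k ≤-refl))) }
... | inj₂ (inj₁ k≡1+t) = record
  { start = 1 ; land = k ; shifted = sym k≡1+t ; start∈P = inj₁ (inj₂ refl)
  ; land<n = k<2k (≤-trans (s≤s z≤n) k≥3)
  ; land∉P = upper-gap k≥3 ≤-refl (<⇒≢ (m<m+n k (s≤s z≤n))) }
... | inj₂ (inj₂ k≤t) = record
  { start = 0 ; land = t ; shifted = refl ; start∈P = inj₁ (inj₁ refl)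
  ; land<n = t<2k ; land∉P = upper-gap k≥3 k≤t t≢k+2 }

2k∸[k+2]≡k∸2 : ∀ k → 2 * k ∸ (k + 2) ≡ k ∸ 2
2k∸[k+2]≡k∸2 k = trans ([m+n]∸[m+o]≡n∸o k (k + 0) 2) (cong (_∸ 2) (+-identityʳ k))

escape-k∸2 : ∀ {k} → 3 ≤ k → Escape (InA k) (2 * k) (k ∸ 2)
escape-k∸2 {k} k≥3 = escape k≥3 (∸-monoˡ-≤ 2 k≥3)
  (≤-<-trans (m∸n≤m k 2) (k<2k (≤-trans (s≤s z≤n) k≥3)))
  (<⇒≢ (≤-<-trans (m∸n≤m k 2) (m<m+n k (s≤s z≤n))))

-- Main theorem: apply no-escape to h, or to -h when h has representative k+2.
-- For k = suc k' the modulus suc (2k ∸ 1) is 2k by computation.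
mainTheorem4 : (k : ℕ) → 3 ≤ k →
    (H : Subset (suc (2 * k ∸ 1))) → IsSubgroup H → NonTrivial H →
    ¬ ((Aₖ k ⊕ H) ≐ Aₖ k)
mainTheorem4 k@(suc _) k≥3 H H-subgroup (h , h∈H , h≢0) A+H≐A with toℕ h ≟ k + 2
... | no t≢k+2 = no-escape (InA k) H A+H≐A h∈H
                   (escape k≥3 (toℕ-nonzero h h≢0) (toℕ<n h) t≢k+2)
... | yes t≡k+2 = no-escape (InA k) H A+H≐A (IsSubgroup.closed- H-subgroup h∈H)
                    (subst (Escape (InA k) (2 * k)) (sym toℕ-[-h]) (escape-k∸2 k≥3))
  where
  toℕ-[-h] : toℕ (-ₙ h) ≡ k ∸ 2
  toℕ-[-h] = trans (toℕ--ₙ h h≢0) (trans (cong (2 * k ∸_) t≡k+2) (2k∸[k+2]≡k∸2 k))
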